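{- For every category $\mathbf{C}$, the 2-category $\mathbf{CLat}_\sqcap(\mathbf{C})$ has comma objects: for every cospan $f\colon a\to c$, $g\colon b\to c$ of 1-cells in $\mathbf{CLat}_\sqcap(\mathbf{C})$ there exists a comma object of $f$ and $g$ in $\mathbf{CLat}_\sqcap(\mathbf{C})$.
   Context: A fibration $p\colon\mathbf{E}\to\mathbf{C}$ is a $\mathbf{CLat}_\sqcap$-fibration if each fibre $\mathbf{E}_X$ is a complete lattice and every reindexing functor $f^*$ preserves all meets. $\mathbf{Fib}(\mathbf{C})$ is the 2-category of fibrations over $\mathbf{C}$, fibred functors over $\mathbf{C}$ (functors commuting with the projections and preserving cartesian morphisms) and vertical natural transformations. $\mathbf{CLat}_\sqcap(\mathbf{C})$ is the sub-2-category whose 0-cells are $\mathbf{CLat}_\sqcap$-fibrations over $\mathbf{C}$, whose 1-cells are fibred functors whose restriction to each fibre preserves all meets, and whose 2-cells are vertical natural transformations. In a 2-category, a comma object of $f\colon a\to c$, $g\colon b\to c$ is a 0-cell $x$ with 1-cells $p\colon x\to a$, $q\colon x\to b$ and a 2-cell $\alpha\colon fp\Rightarrow gq$ such that (one-dimensional property) every 2-cell $\alpha'\colon fp'\Rightarrow gq'$ with $p'\colon x'\to a$, $q'\colon x'\to b$ equals $\alpha h$ for a unique $h\colon x'\to x$ (with $ph=p'$, $qh=q'$); and (two-dimensional property) for 1-cells $h_1,h_2\colon y\to x$ and 2-cells $\beta_1\colon ph_1\Rightarrow ph_2$, $\beta_2\colon qh_1\Rightarrow qh_2$ with $(g\beta_2)\circ(\alpha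 h_1)=(\alpha h_2)\circ(f\beta_1)$, there is a unique 2-cell $\beta\colon h_1\Rightarrow h_2$ with $p\beta=\beta_1$ and $q\beta=\beta_2$. -}

module Defs where

open import Level using (Level; _⊔_; suc)
open import Relation.Binary.PropositionalEquality using (_≡_; refl; cong; subst₂)
open import Relation.Binary.Structures using (IsEquivalence)
open import Data.Product using (Σ; _×_; _,_)

record Category (o ℓ e : Level) : Set (suc (o ⊔ ℓ ⊔ e)) where
  infixr 9 _∘_
  infix  4 _≈_
  field
    Obj       : Set o
    _⇒_       : Obj → Obj → Set ℓ
    _≈_       : ∀ {A B} → A ⇒ B → A ⇒ B → Set e
    id        : ∀ {A} → A ⇒ A
    _∘_       : ∀ {A B C} → B ⇒ C → A ⇒ B → A ⇒ C
    equiv     : ∀ {A B} → IsEquivalence (_≈_ {A} {B})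
    assoc     : ∀ {A B C D} {f : A ⇒ B} {g : B ⇒ C} {h : C ⇒ D} →
                (h ∘ g) ∘ f ≈ h ∘ (g ∘ f)
    identityˡ : ∀ {A B} {f : A ⇒ B} → id ∘ f ≈ f
    identityʳ : ∀ {A B} {f : A ⇒ B} → f ∘ id ≈ f
    ∘-resp-≈  : ∀ {A B C} {f h : B ⇒ C} {g i : A ⇒ B} →
                f ≈ h → g ≈ i → f ∘ g ≈ h ∘ i

-- Displayed categories over C (equivalently: a category E together with
-- a functor p : E → C; Obj[ X ] are the objects over X, X' ⇒[ u ] Y' the
-- morphisms over u, and _≈′_ the equality of E, which lies over equality
-- in C).  transp moves a morphism over u to one over an equal v (in the
-- "functor p : E → C" presentation, Hom[u] = {f | p f ≈ u}).

module _ {o ℓ e : Level} (C : Category o ℓ e) where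
  private module C = Category C
  open C using (Obj; _⇒_; _≈_; _∘_)

  record Displayed (κ : Level) : Set (o ⊔ ℓ ⊔ e ⊔ suc κ) where
    infixr 9 _∘′_
    infix  4 _≈′_
    field
      Obj[_]   : Obj → Set κ
      _⇒[_]_   : ∀ {X Y} → Obj[ X ] → X ⇒ Y → Obj[ Y ] → Set κ
      _≈′_     : ∀ {X Y} {u v : X ⇒ Y} {X′ : Obj[ X ]} {Y′ : Obj[ Y ]} →
                 X′ ⇒[ u ] Y′ → X′ ⇒[ v ] Y′ → Set κ
      id′      : ∀ {X} {X′ : Obj[ X ]} → X′ ⇒[ C.id ] X′
      _∘′_     : ∀ {X Y Z} {u : Y ⇒ Z} {v : X ⇒ Y}
                 {X′ : Obj[ X ]} {Y′ : Obj[ Y ]} {Z′ : Obj[ Z ]} →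
                 Y′ ⇒[ u ] Z′ → X′ ⇒[ v ] Y′ → X′ ⇒[ u ∘ v ] Z′
      ≈′-refl  : ∀ {X Y} {u : X ⇒ Y} {X′ Y′} {f : X′ ⇒[ u ] Y′} → f ≈′ f
      ≈′-sym   : ∀ {X Y} {u v : X ⇒ Y} {X′ Y′}
                 {f : X′ ⇒[ u ] Y′} {g : X′ ⇒[ v ] Y′} → f ≈′ g → g ≈′ f
      ≈′-trans : ∀ {X Y} {u v w : X ⇒ Y} {X′ Y′}
                 {f : X′ ⇒[ u ] Y′} {g : X′ ⇒[ v ] Y′} {h : X′ ⇒[ w ] Y′} →
                 f ≈′ g → g ≈′ h → f ≈′ h
      ≈′-over  : ∀ {X Y} {u v : X ⇒ Y} {X′ Y′}
                 {f : X′ ⇒[ u ] Y′} {g : X′ ⇒[ v ] Y′} → f ≈′ g → u ≈ v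
      identityˡ′ : ∀ {X Y} {u : X ⇒ Y} {X′ Y′} {f : X′ ⇒[ u ] Y′} → id′ ∘′ f ≈′ f
      identityʳ′ : ∀ {X Y} {u : X ⇒ Y} {X′ Y′} {f : X′ ⇒[ u ] Y′} → f ∘′ id′ ≈′ f
      assoc′   : ∀ {W X Y Z} {u : W ⇒ X} {v : X ⇒ Y} {w : Y ⇒ Z}
                 {W′ X′ Y′ Z′}
                 {f : W′ ⇒[ u ] X′} {g : X′ ⇒[ v ] Y′} {h : Y′ ⇒[ w ] Z′} →
                 (h ∘′ g) ∘′ f ≈′ h ∘′ (g ∘′ f)
      ∘′-resp-≈′ : ∀ {X Y Z} {u u′ : Y ⇒ Z} {v v′ : X ⇒ Y} {X′ Y′ Z′}
                 {f : Y′ ⇒[ u ] Z′} {f′ : Y′ ⇒[ u′ ] Z′}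
                 {g : X′ ⇒[ v ] Y′} {g′ : X′ ⇒[ v′ ] Y′} →
                 f ≈′ f′ → g ≈′ g′ → f ∘′ g ≈′ f′ ∘′ g′
      transp   : ∀ {X Y} {u v : X ⇒ Y} {X′ Y′} → u ≈ v →
                 X′ ⇒[ u ] Y′ → X′ ⇒[ v ] Y′
      transp-≈′ : ∀ {X Y} {u v : X ⇒ Y} {X′ Y′} (eq : u ≈ v)
                 (f : X′ ⇒[ u ] Y′) → transp eq f ≈′ f

  module _ {κ : Level} (E : Displayed κ) where
    open Displayed E

    record IsCartesian {X Y} {u : X ⇒ Y} {X′ : Obj[ X ]} {Y′ : Obj[ Y ]}
                       (f : X′ ⇒[ u ] Y′) : Set (o ⊔ ℓ ⊔ e ⊔ κ) where
      field
        factor   : ∀ {Z} {w : Z ⇒ X} {v : Z ⇒ Y} {Z′ : Obj[ Z ]} →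
                   u ∘ w ≈ v → Z′ ⇒[ v ] Y′ → Z′ ⇒[ w ] X′
        factor-commutes : ∀ {Z} {w : Z ⇒ X} {v : Z ⇒ Y} {Z′ : Obj[ Z ]}
                   (eq : u ∘ w ≈ v) (g : Z′ ⇒[ v ] Y′) →
                   f ∘′ factor eq g ≈′ g
        factor-unique : ∀ {Z} {w : Z ⇒ X} {v : Z ⇒ Y} {Z′ : Obj[ Z ]}
                   (eq : u ∘ w ≈ v) (g : Z′ ⇒[ v ] Y′) (h : Z′ ⇒[ w ] X′) →
                   f ∘′ h ≈′ g → h ≈′ factor eq g

    _≤ᵥ_ : ∀ {X} → Obj[ X ] → Obj[ X ] → Set κ
    a ≤ᵥ b = a ⇒[ C.id ] b

    record IsMeet {X} {I : Set κ} (es : I → Obj[ X ]) (m : Obj[ X ]) : Set κ where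
      field
        lower    : ∀ i → m ≤ᵥ es i
        greatest : ∀ (x : Obj[ X ]) → (∀ i → x ≤ᵥ es i) → x ≤ᵥ m

  record Fibration (κ : Level) : Set (o ⊔ ℓ ⊔ e ⊔ suc κ) where
    field
      disp : Displayed κ
    open Displayed disp public
    field
      _*_       : ∀ {X Y} → X ⇒ Y → Obj[ Y ] → Obj[ X ]
      lift      : ∀ {X Y} (u : X ⇒ Y) (Y′ : Obj[ Y ]) → (u * Y′) ⇒[ u ] Y′
      lift-cart : ∀ {X Y} (u : X ⇒ Y) (Y′ : Obj[ Y ]) → IsCartesian disp (lift u Y′)

  -- CLat_⊓-fibrations: every fibre is a complete lattice (a thin,
  -- antisymmetric category with meets of all families indexed by types of
  -- the same universe), and every reindexing u* preserves all meets.
  record CLatFib (κ : Level) : Set (o ⊔ ℓ ⊔ e ⊔ suc κ) where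
    field
      fib : Fibration κ
    open Fibration fib public
    field
      thin     : ∀ {X} {a b : Obj[ X ]} (f g : a ⇒[ C.id ] b) → f ≈′ g
      antisym  : ∀ {X} {a b : Obj[ X ]} → a ⇒[ C.id ] b → b ⇒[ C.id ] a → a ≡ b
      ⊓        : ∀ {X} {I : Set κ} (es : I → Obj[ X ]) → Obj[ X ]
      ⊓-isMeet : ∀ {X} {I : Set κ} (es : I → Obj[ X ]) → IsMeet disp es (⊓ es)
      *-preserves-meets : ∀ {X Y} (u : X ⇒ Y) {I : Set κ}
                 (es : I → Obj[ Y ]) (m : Obj[ Y ]) →
                 IsMeet disp es m → IsMeet disp (λ i → u * es i) (u * m)

  module _ {κ₁ κ₂ : Level} (E : Displayed κ₁) (D : Displayed κ₂) where
    private
      module E = Displayed E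
      module D = Displayed D

    record FData : Set (o ⊔ ℓ ⊔ κ₁ ⊔ κ₂) where
      field
        F₀ : ∀ {X} → E.Obj[ X ] → D.Obj[ X ]
        F₁ : ∀ {X Y} {u : X ⇒ Y} {X′ Y′} → X′ E.⇒[ u ] Y′ → F₀ X′ D.⇒[ u ] F₀ Y′

    record IsFibredFunctor (F : FData) : Set (o ⊔ ℓ ⊔ e ⊔ κ₁ ⊔ κ₂) where
      open FData F
      field
        F-id   : ∀ {X} {X′ : E.Obj[ X ]} → F₁ (E.id′ {X′ = X′}) D.≈′ D.id′
        F-∘    : ∀ {X Y Z} {u : Y ⇒ Z} {v : X ⇒ Y} {X′ Y′ Z′}
                 {f : Y′ E.⇒[ u ] Z′} {g : X′ E.⇒[ v ] Y′} →
                 F₁ (f E.∘′ g) D.≈′ F₁ f D.∘′ F₁ g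
        F-resp : ∀ {X Y} {u v : X ⇒ Y} {X′ Y′}
                 {f : X′ E.⇒[ u ] Y′} {g : X′ E.⇒[ v ] Y′} →
                 f E.≈′ g → F₁ f D.≈′ F₁ g
        F-cart : ∀ {X Y} {u : X ⇒ Y} {X′ Y′} {f : X′ E.⇒[ u ] Y′} →
                 IsCartesian E f → IsCartesian D (F₁ f)

    record NatTrans (F G : FData) : Set (o ⊔ ℓ ⊔ κ₁ ⊔ κ₂) where
      private
        module F = FData F
        module G = FData G
      field
        η       : ∀ {X} (X′ : E.Obj[ X ]) → F.F₀ X′ D.⇒[ C.id ] G.F₀ X′
        commute : ∀ {X Y} {u : X ⇒ Y} {X′ Y′} (f : X′ E.⇒[ u ] Y′) →
                  G.F₁ f D.∘′ η X′ D.≈′ η Y′ D.∘′ F.F₁ f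

    _≋_ : ∀ {F G} → NatTrans F G → NatTrans F G → Set (o ⊔ κ₁ ⊔ κ₂)
    α ≋ β = ∀ {X} (X′ : E.Obj[ X ]) → NatTrans.η α X′ D.≈′ NatTrans.η β X′

    record _≐_ (F G : FData) : Set (o ⊔ ℓ ⊔ κ₁ ⊔ κ₂) where
      private
        module F = FData F
        module G = FData G
      field
        eq₀ : ∀ {X} (X′ : E.Obj[ X ]) → F.F₀ X′ ≡ G.F₀ X′
        eq₁ : ∀ {X Y} {u : X ⇒ Y} {X′ Y′} (f : X′ E.⇒[ u ] Y′) →
              subst₂ (λ a b → a D.⇒[ u ] b) (eq₀ X′) (eq₀ Y′) (F.F₁ f) D.≈′ G.F₁ f

    _≋⟨_,_⟩_ : ∀ {F G F′ G′} → NatTrans F G →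
               (∀ {X} (X′ : E.Obj[ X ]) → FData.F₀ F X′ ≡ FData.F₀ F′ X′) →
               (∀ {X} (X′ : E.Obj[ X ]) → FData.F₀ G X′ ≡ FData.F₀ G′ X′) →
               NatTrans F′ G′ → Set (o ⊔ κ₁ ⊔ κ₂)
    α ≋⟨ eF , eG ⟩ α′ = ∀ {X} (X′ : E.Obj[ X ]) →
      subst₂ (λ a b → a D.⇒[ C.id ] b) (eF X′) (eG X′) (NatTrans.η α X′)
        D.≈′ NatTrans.η α′ X′

  module _ {κ : Level} where
    open CLatFib

    record _⟶_ (A B : CLatFib κ) : Set (o ⊔ ℓ ⊔ e ⊔ suc κ) where
      field
        dat    : FData (disp A) (disp B)
        fibred : IsFibredFunctor (disp A) (disp B) dat
        preserves-meets : ∀ {X} {I : Set κ} (es : I → Obj[_] A X)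
                 (m : Obj[_] A X) → IsMeet (disp A) es m →
                 IsMeet (disp B) (λ i → FData.F₀ dat (es i)) (FData.F₀ dat m)
      open FData dat public
      open IsFibredFunctor fibred public

    open _⟶_

    _⇒₂_ : ∀ {A B : CLatFib κ} → A ⟶ B → A ⟶ B → Set (o ⊔ ℓ ⊔ κ)
    _⇒₂_ {A} {B} F G = NatTrans (disp A) (disp B) (dat F) (dat G)

    infixr 9 _∘₁_
    _∘₁_ : ∀ {A B D : CLatFib κ} → B ⟶ D → A ⟶ B → A ⟶ D
    _∘₁_ {A} {B} {D} G F = record
      { dat = record { F₀ = λ a → F₀ G (F₀ F a) ; F₁ = λ f → F₁ G (F₁ F f) }
      ; fibred = record
        { F-id   = ≈′-trans D (F-resp G (F-id F)) (F-id G)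
        ; F-∘    = ≈′-trans D (F-resp G (F-∘ F)) (F-∘ G)
        ; F-resp = λ p → F-resp G (F-resp F p)
        ; F-cart = λ c → F-cart G (F-cart F c)
        }
      ; preserves-meets = λ es m isM →
          preserves-meets G (λ i → F₀ F (es i)) (F₀ F m)
            (preserves-meets F es m isM)
      }

    _◁_ : ∀ {A B D : CLatFib κ} {F G : B ⟶ D} → F ⇒₂ G → (h : A ⟶ B) →
          (F ∘₁ h) ⇒₂ (G ∘₁ h)
    α ◁ h = record
      { η       = λ a → NatTrans.η α (F₀ h a)
      ; commute = λ f → NatTrans.commute α (F₁ h f)
      }

    _▷_ : ∀ {A B D : CLatFib κ} {F G : A ⟶ B} → (k : B ⟶ D) → F ⇒₂ G →
          (k ∘₁ F) ⇒₂ (k ∘₁ G)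
    _▷_ {D = D} {F} {G} k β = record
      { η       = λ a → F₁ k (NatTrans.η β a)
      ; commute = λ f →
          ≈′-trans D (≈′-sym D (F-∘ k))
            (≈′-trans D (F-resp k (NatTrans.commute β f)) (F-∘ k))
      }

    infixr 9 _∘ᵥ_
    _∘ᵥ_ : ∀ {A B : CLatFib κ} {F G H : A ⟶ B} → G ⇒₂ H → F ⇒₂ G → F ⇒₂ H
    _∘ᵥ_ {A} {B} {F} {G} {H} β α = record
      { η       = λ a → transp B C.identityˡ (ηβ a ∘′B ηα a)
      ; commute = λ {X} {Y} {u} {X′} {Y′} f →
          ≈′-trans B (∘′-resp-≈′ B (≈′-refl B) (transp-≈′ B C.identityˡ _))
          (≈′-trans B (≈′-sym B (assoc′ B))
          (≈′-trans B (∘′-resp-≈′ B (NatTrans.commute β f) (≈′-refl B))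
          (≈′-trans B (assoc′ B)
          (≈′-trans B (∘′-resp-≈′ B (≈′-refl B) (NatTrans.commute α f))
          (≈′-trans B (≈′-sym B (assoc′ B))
            (∘′-resp-≈′ B (≈′-sym B (transp-≈′ B C.identityˡ _))
                          (≈′-refl B)))))))
      }
      where
        ηβ = NatTrans.η β
        ηα = NatTrans.η α
        _∘′B_ = Displayed._∘′_ (disp B)

    _≐₁_ : ∀ {A B : CLatFib κ} → A ⟶ B → A ⟶ B → Set (o ⊔ ℓ ⊔ κ)
    _≐₁_ {A} {B} F G = _≐_ (disp A) (disp B) (dat F) (dat G)

    _≋₂_ : ∀ {A B : CLatFib κ} {F G : A ⟶ B} → F ⇒₂ G → F ⇒₂ G → Set (o ⊔ κ)
    _≋₂_ {A} {B} α β = _≋_ (disp A) (disp B) α β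

    record IsComma {A B D : CLatFib κ} (f : A ⟶ D) (g : B ⟶ D)
                   (X : CLatFib κ) (p : X ⟶ A) (q : X ⟶ B)
                   (α : (f ∘₁ p) ⇒₂ (g ∘₁ q)) : Set (o ⊔ ℓ ⊔ e ⊔ suc κ) where
      private
        whisk : ∀ {Y : CLatFib κ} (k : X ⟶ A) (h : Y ⟶ X) (k′ : Y ⟶ A) →
                (k ∘₁ h) ≐₁ k′ → ∀ {Z} (y : Obj[_] Y Z) →
                F₀ f (F₀ k (F₀ h y)) ≡ F₀ f (F₀ k′ y)
        whisk _ _ _ e y = cong (F₀ f) (_≐_.eq₀ e y)
        whiskg : ∀ {Y : CLatFib κ} (k : X ⟶ B) (h : Y ⟶ X) (k′ : Y ⟶ B) →
                 (k ∘₁ h) ≐₁ k′ → ∀ {Z} (y : Obj[_] Y Z) →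
                 F₀ g (F₀ k (F₀ h y)) ≡ F₀ g (F₀ k′ y)
        whiskg _ _ _ e y = cong (F₀ g) (_≐_.eq₀ e y)
      field
        fill    : ∀ {Y : CLatFib κ} (p′ : Y ⟶ A) (q′ : Y ⟶ B) →
                  (f ∘₁ p′) ⇒₂ (g ∘₁ q′) → Y ⟶ X
        fill-p  : ∀ {Y : CLatFib κ} (p′ : Y ⟶ A) (q′ : Y ⟶ B)
                  (α′ : (f ∘₁ p′) ⇒₂ (g ∘₁ q′)) → (p ∘₁ fill p′ q′ α′) ≐₁ p′
        fill-q  : ∀ {Y : CLatFib κ} (p′ : Y ⟶ A) (q′ : Y ⟶ B)
                  (α′ : (f ∘₁ p′) ⇒₂ (g ∘₁ q′)) → (q ∘₁ fill p′ q′ α′) ≐₁ q′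
        fill-α  : ∀ {Y : CLatFib κ} (p′ : Y ⟶ A) (q′ : Y ⟶ B)
                  (α′ : (f ∘₁ p′) ⇒₂ (g ∘₁ q′)) →
                  _≋⟨_,_⟩_ (disp Y) (disp D) (_◁_ {F = f ∘₁ p} {G = g ∘₁ q} α (fill p′ q′ α′))
                    (whisk p (fill p′ q′ α′) p′ (fill-p p′ q′ α′))
                    (whiskg q (fill p′ q′ α′) q′ (fill-q p′ q′ α′))
                     α′
        fill-unique : ∀ {Y : CLatFib κ} (p′ : Y ⟶ A) (q′ : Y ⟶ B)
                  (α′ : (f ∘₁ p′) ⇒₂ (g ∘₁ q′)) (h : Y ⟶ X)
                  (ph : (p ∘₁ h) ≐₁ p′) (qh : (q ∘₁ h) ≐₁ q′) →
                  _≋⟨_,_⟩_ (disp Y) (disp D)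
                    (_◁_ {F = f ∘₁ p} {G = g ∘₁ q} α h)
                    (whisk p h p′ ph) (whiskg q h q′ qh) α′ →
                  h ≐₁ fill p′ q′ α′
        lift₂   : ∀ {Y : CLatFib κ} (h₁ h₂ : Y ⟶ X)
                  (β₁ : (p ∘₁ h₁) ⇒₂ (p ∘₁ h₂)) (β₂ : (q ∘₁ h₁) ⇒₂ (q ∘₁ h₂)) →
                  _≋₂_ {F = f ∘₁ p ∘₁ h₁} {G = g ∘₁ q ∘₁ h₂}
                    (_∘ᵥ_ {F = f ∘₁ p ∘₁ h₁} {G = g ∘₁ q ∘₁ h₁} {H = g ∘₁ q ∘₁ h₂}
                      (_▷_ {F = q ∘₁ h₁} {G = q ∘₁ h₂} g β₂)
                      (_◁_ {F = f ∘₁ p} {G = g ∘₁ q} α h₁))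
                    (_∘ᵥ_ {F = f ∘₁ p ∘₁ h₁} {G = f ∘₁ p ∘₁ h₂} {H = g ∘₁ q ∘₁ h₂}
                      (_◁_ {F = f ∘₁ p} {G = g ∘₁ q} α h₂)
                      (_▷_ {F = p ∘₁ h₁} {G = p ∘₁ h₂} f β₁)) →
                  Σ (h₁ ⇒₂ h₂) (λ β →
                    _≋₂_ {F = p ∘₁ h₁} {G = p ∘₁ h₂} (_▷_ {F = h₁} {G = h₂} p β) β₁ ×
                    _≋₂_ {F = q ∘₁ h₁} {G = q ∘₁ h₂} (_▷_ {F = h₁} {G = h₂} q β) β₂)
        lift₂-unique : ∀ {Y : CLatFib κ} (h₁ h₂ : Y ⟶ X)
                  (β₁ : (p ∘₁ h₁) ⇒₂ (p ∘₁ h₂)) (β₂ : (q ∘₁ h₁) ⇒₂ (q ∘₁ h₂)) →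
                  _≋₂_ {F = f ∘₁ p ∘₁ h₁} {G = g ∘₁ q ∘₁ h₂}
                    (_∘ᵥ_ {F = f ∘₁ p ∘₁ h₁} {G = g ∘₁ q ∘₁ h₁} {H = g ∘₁ q ∘₁ h₂}
                      (_▷_ {F = q ∘₁ h₁} {G = q ∘₁ h₂} g β₂)
                      (_◁_ {F = f ∘₁ p} {G = g ∘₁ q} α h₁))
                    (_∘ᵥ_ {F = f ∘₁ p ∘₁ h₁} {G = f ∘₁ p ∘₁ h₂} {H = g ∘₁ q ∘₁ h₂}
                      (_◁_ {F = f ∘₁ p} {G = g ∘₁ q} α h₂)
                      (_▷_ {F = p ∘₁ h₁} {G = p ∘₁ h₂} f β₁)) →
                  (β β′ : h₁ ⇒₂ h₂) →
                  _≋₂_ {F = p ∘₁ h₁} {G = p ∘₁ h₂} (_▷_ {F = h₁} {G = h₂} p β) β₁ →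
                  _≋₂_ {F = q ∘₁ h₁} {G = q ∘₁ h₂} (_▷_ {F = h₁} {G = h₂} q β) β₂ →
                  _≋₂_ {F = p ∘₁ h₁} {G = p ∘₁ h₂} (_▷_ {F = h₁} {G = h₂} p β′) β₁ →
                  _≋₂_ {F = q ∘₁ h₁} {G = q ∘₁ h₂} (_▷_ {F = h₁} {G = h₂} q β′) β₂ →
                  _≋₂_ {F = h₁} {G = h₂} β β′

    record CommaObject {A B D : CLatFib κ} (f : A ⟶ D) (g : B ⟶ D)
                       : Set (o ⊔ ℓ ⊔ e ⊔ suc κ) where
      field
        obj     : CLatFib κ
        π₁      : obj ⟶ A
        π₂      : obj ⟶ B
        cell    : (f ∘₁ π₁) ⇒₂ (g ∘₁ π₂)
        isComma : IsComma f g obj π₁ π₂ cell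

{-# OPTIONS --safe #-}
module Submission where

-- A fibration with thin fibres is thin over its base: two morphisms over
-- equal base maps both factor through the cartesian lift by vertical maps,
-- which are equal.  So every equation between morphisms or 2-cells that
-- typechecks holds, and only objects need real work.  The comma object of
-- f : A → D ← B : g has as fibre over X the pairs (a , b) with
-- f a ≤ g b in D_X, ordered componentwise.  Meets and reindexing are
-- computed componentwise; they stay in the comma because f preserves meets
-- and g preserves cartesian lifts.

open import Level using (Level; Lift; lift; _⊔_)
open import Data.Bool using (Bool; true; false)
open import Data.Product using (_,_)
open import Relation.Binary.PropositionalEquality using (_≡_; refl; subst; cong)
open import Relation.Binary.Structures using (IsEquivalence)
open import Axiom.UniquenessOfIdentityProofs.WithK using (uip)
open import Defs

module _ {o ℓ e : Level} (C : Category o ℓ e) where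
  open Category C

  private
    ≈-refl : ∀ {X Y} {u : X ⇒ Y} → u ≈ u
    ≈-refl = IsEquivalence.refl equiv

    id-comm : ∀ {X Y} {u : X ⇒ Y} → u ∘ id ≈ id ∘ u
    id-comm = IsEquivalence.trans equiv identityʳ (IsEquivalence.sym equiv identityˡ)

  module _ {κ : Level} (E : Displayed C κ) where
    open Displayed E

    ThinFibres : Set (o ⊔ κ)
    ThinFibres = ∀ {X} {a b : Obj[ X ]} (f g : a ⇒[ id ] b) → f ≈′ g

    ThinOver : Set (o ⊔ ℓ ⊔ e ⊔ κ)
    ThinOver = ∀ {X Y} {u v : X ⇒ Y} {X′ Y′}
               (f : X′ ⇒[ u ] Y′) (g : X′ ⇒[ v ] Y′) → u ≈ v → f ≈′ g

    isCartesian-if-factors : ThinOver →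
      ∀ {X Y} {u : X ⇒ Y} {X′ Y′} {f : X′ ⇒[ u ] Y′} →
      (∀ {Z} {w : Z ⇒ X} {v : Z ⇒ Y} {Z′ : Obj[ Z ]} →
         u ∘ w ≈ v → Z′ ⇒[ v ] Y′ → Z′ ⇒[ w ] X′) →
      IsCartesian C E f
    isCartesian-if-factors thin factor = record
      { factor          = factor
      ; factor-commutes = λ eq _ → thin _ _ eq
      ; factor-unique   = λ _ _ _ _ → thin _ _ ≈-refl
      }

    isCartesian-if-above-cartesian : ThinOver →
      ∀ {X Y} {u : X ⇒ Y} {X″ X′ Y′} {f′ : X″ ⇒[ u ] Y′} →
      IsCartesian C E f′ → X″ ⇒[ id ] X′ → (f : X′ ⇒[ u ] Y′) →
      IsCartesian C E f
    isCartesian-if-above-cartesian thin f′-cart s f = isCartesian-if-factors thin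
      (λ eq g → transp identityˡ (s ∘′ IsCartesian.factor f′-cart eq g))

  thinFibres⇒thinOver : ∀ {κ} (P : Fibration C κ) →
                        ThinFibres (Fibration.disp P) → ThinOver (Fibration.disp P)
  thinFibres⇒thinOver P thin {v = v} {Y′ = Y′} f g u≈v =
    ≈′-trans (≈′-sym (transp-≈′ u≈v f))
    (≈′-trans (≈′-sym (factor-commutes identityʳ (transp u≈v f)))
    (≈′-trans (∘′-resp-≈′ ≈′-refl (thin _ _))
      (factor-commutes identityʳ g)))
    where
      open Fibration P
      open IsCartesian (lift-cart v Y′)

  module CLatFibProperties {κ : Level} (E : CLatFib C κ) where
    open CLatFib E hiding (lift)

    thinOver : ThinOver disp
    thinOver = thinFibres⇒thinOver fib thin

    -- Binary meets turn the order of the fibre into an equation, which is a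
    -- proposition; this is what makes the comma fibre antisymmetric.
    infixr 7 _∧_
    _∧_ : ∀ {X} → Obj[ X ] → Obj[ X ] → Obj[ X ]
    x ∧ y = ⊓ {I = Lift κ Bool} (λ { (lift true) → x ; (lift false) → y })

    x≤y⇒x∧y≡x : ∀ {X} {x y : Obj[ X ]} → x ⇒[ id ] y → x ∧ y ≡ x
    x≤y⇒x∧y≡x {x = x} x≤y = antisym (lower (lift true)) (greatest x x≤x,y)
      where
        open IsMeet (⊓-isMeet _)
        x≤x,y : ∀ i → _
        x≤x,y (lift true)  = id′
        x≤x,y (lift false) = x≤y

    x∧y≡x⇒x≤y : ∀ {X} {x y : Obj[ X ]} → x ∧ y ≡ x → x ⇒[ id ] y
    x∧y≡x⇒x≤y x∧y≡x =
      subst (λ z → z ⇒[ id ] _) x∧y≡x (IsMeet.lower (⊓-isMeet _) (lift false))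

  module Comma {κ : Level} {A B D : CLatFib C κ}
               (f : _⟶_ C A D) (g : _⟶_ C B D) where
    private
      module A = CLatFib A
      module B = CLatFib B
      module D = CLatFib D
      module f = _⟶_ f
      module g = _⟶_ g
      module A′ = CLatFibProperties A
      module B′ = CLatFibProperties B
      module D′ = CLatFibProperties D

    record CommaObj (X : Obj) : Set κ where
      constructor commaObj′
      field
        left  : A.Obj[ X ]
        right : B.Obj[ X ]
        f≤g   : f.F₀ left D′.∧ g.F₀ right ≡ f.F₀ left
    open CommaObj

    commaObj : ∀ {X} (a : A.Obj[ X ]) (b : B.Obj[ X ]) →
               f.F₀ a D.⇒[ id ] g.F₀ b → CommaObj X
    commaObj a b fa≤gb = commaObj′ a b (D′.x≤y⇒x∧y≡x fa≤gb)

    leq : ∀ {X} (x : CommaObj X) → f.F₀ (left x) D.⇒[ id ] g.F₀ (right x)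
    leq x = D′.x∧y≡x⇒x≤y (f≤g x)

    CommaObj-≡ : ∀ {X} {x y : CommaObj X} →
                 left x ≡ left y → right x ≡ right y → x ≡ y
    CommaObj-≡ {x = commaObj′ _ _ p} {commaObj′ _ _ q} refl refl =
      cong (commaObj′ _ _) (uip p q)

    record CommaHom {X Y} (x : CommaObj X) (u : X ⇒ Y) (y : CommaObj Y) : Set κ where
      constructor _,,_
      field
        hom₁ : left x A.⇒[ u ] left y
        hom₂ : right x B.⇒[ u ] right y
    open CommaHom

    record _≈ₕ_ {X Y} {u v : X ⇒ Y} {x : CommaObj X} {y : CommaObj Y}
                (φ : CommaHom x u y) (ψ : CommaHom x v y) : Set κ where
      constructor _,≈_
      field
        ≈₁ : hom₁ φ A.≈′ hom₁ ψ
        ≈₂ : hom₂ φ B.≈′ hom₂ ψ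
    open _≈ₕ_

    disp : Displayed C κ
    disp = record
      { Obj[_]     = CommaObj
      ; _⇒[_]_     = CommaHom
      ; _≈′_       = _≈ₕ_
      ; id′        = A.id′ ,, B.id′
      ; _∘′_       = λ φ ψ → (hom₁ φ A.∘′ hom₁ ψ) ,, (hom₂ φ B.∘′ hom₂ ψ)
      ; ≈′-refl    = A.≈′-refl ,≈ B.≈′-refl
      ; ≈′-sym     = λ p → A.≈′-sym (≈₁ p) ,≈ B.≈′-sym (≈₂ p)
      ; ≈′-trans   = λ p q → A.≈′-trans (≈₁ p) (≈₁ q) ,≈ B.≈′-trans (≈₂ p) (≈₂ q)
      ; ≈′-over    = λ p → A.≈′-over (≈₁ p)
      ; identityˡ′ = A.identityˡ′ ,≈ B.identityˡ′
      ; identityʳ′ = A.identityʳ′ ,≈ B.identityʳ′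
      ; assoc′     = A.assoc′ ,≈ B.assoc′
      ; ∘′-resp-≈′ = λ p q → A.∘′-resp-≈′ (≈₁ p) (≈₁ q) ,≈ B.∘′-resp-≈′ (≈₂ p) (≈₂ q)
      ; transp     = λ eq φ → A.transp eq (hom₁ φ) ,, B.transp eq (hom₂ φ)
      ; transp-≈′  = λ eq φ → A.transp-≈′ eq (hom₁ φ) ,≈ B.transp-≈′ eq (hom₂ φ)
      }

    thinOver : ThinOver disp
    thinOver φ ψ eq = A′.thinOver (hom₁ φ) (hom₁ ψ) eq ,≈ B′.thinOver (hom₂ φ) (hom₂ ψ) eq

    isCartesian-pair : ∀ {X Y} {u : X ⇒ Y} {x : CommaObj X} {y : CommaObj Y}
                       {φ : CommaHom x u y} →
                       IsCartesian C A.disp (hom₁ φ) → IsCartesian C B.disp (hom₂ φ) →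
                       IsCartesian C disp φ
    isCartesian-pair cart₁ cart₂ = isCartesian-if-factors disp thinOver (λ eq ψ →
      IsCartesian.factor cart₁ eq (hom₁ ψ) ,, IsCartesian.factor cart₂ eq (hom₂ ψ))

    -- f (u* a) ≤ f a ≤ g b factors through the cartesian g (lift u b).
    _*ᶜ_ : ∀ {X Y} (u : X ⇒ Y) → CommaObj Y → CommaObj X
    u *ᶜ y = commaObj (u A.* left y) (u B.* right y)
      (IsCartesian.factor (g.F-cart (B.lift-cart u (right y))) identityʳ
        (D.transp identityˡ (leq y D.∘′ f.F₁ (A.lift u (left y)))))

    liftᶜ : ∀ {X Y} (u : X ⇒ Y) (y : CommaObj Y) → CommaHom (u *ᶜ y) u y
    liftᶜ u y = A.lift u (left y) ,, B.lift u (right y)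

    ⊓ᶜ : ∀ {X} {I : Set κ} → (I → CommaObj X) → CommaObj X
    ⊓ᶜ es = commaObj (A.⊓ (λ i → left (es i))) (B.⊓ (λ i → right (es i)))
      (IsMeet.greatest g⊓-isMeet _ (λ i →
        D.transp identityˡ (leq (es i) D.∘′ IsMeet.lower f⊓-isMeet i)))
      where
        f⊓-isMeet = f.preserves-meets _ _ (A.⊓-isMeet (λ i → left (es i)))
        g⊓-isMeet = g.preserves-meets _ _ (B.⊓-isMeet (λ i → right (es i)))

    isMeet-pair : ∀ {X} {I : Set κ} {es : I → CommaObj X} {m : CommaObj X} →
                  IsMeet C A.disp (λ i → left (es i)) (left m) →
                  IsMeet C B.disp (λ i → right (es i)) (right m) →
                  IsMeet C disp es m
    isMeet-pair m₁ m₂ = record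
      { lower    = λ i → IsMeet.lower m₁ i ,, IsMeet.lower m₂ i
      ; greatest = λ x x≤es → IsMeet.greatest m₁ (left x) (λ i → hom₁ (x≤es i))
                           ,, IsMeet.greatest m₂ (right x) (λ i → hom₂ (x≤es i))
      }

    ⊓ᶜ-isMeet : ∀ {X} {I : Set κ} (es : I → CommaObj X) → IsMeet C disp es (⊓ᶜ es)
    ⊓ᶜ-isMeet es = isMeet-pair (A.⊓-isMeet _) (B.⊓-isMeet _)

    -- Any meet lies above ⊓ᶜ es, whose components are meets.
    isMeet-left : ∀ {X} {I : Set κ} {es : I → CommaObj X} {m : CommaObj X} →
                  IsMeet C disp es m → IsMeet C A.disp (λ i → left (es i)) (left m)
    isMeet-left {es = es} m-isMeet = record
      { lower    = λ i → hom₁ (lower i)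
      ; greatest = λ a a≤es → A.transp identityˡ
          (hom₁ (greatest (⊓ᶜ es) (IsMeet.lower (⊓ᶜ-isMeet es)))
            A.∘′ IsMeet.greatest (A.⊓-isMeet _) a a≤es)
      }
      where open IsMeet m-isMeet

    isMeet-right : ∀ {X} {I : Set κ} {es : I → CommaObj X} {m : CommaObj X} →
                   IsMeet C disp es m → IsMeet C B.disp (λ i → right (es i)) (right m)
    isMeet-right {es = es} m-isMeet = record
      { lower    = λ i → hom₂ (lower i)
      ; greatest = λ b b≤es → B.transp identityˡ
          (hom₂ (greatest (⊓ᶜ es) (IsMeet.lower (⊓ᶜ-isMeet es)))
            B.∘′ IsMeet.greatest (B.⊓-isMeet _) b b≤es)
      }
      where open IsMeet m-isMeet

    comma : CLatFib C κ
    comma = record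
      { fib      = record
        { disp      = disp
        ; _*_       = _*ᶜ_
        ; lift      = liftᶜ
        ; lift-cart = λ u y →
            isCartesian-pair (A.lift-cart u (left y)) (B.lift-cart u (right y))
        }
      ; thin     = λ φ ψ → A.thin (hom₁ φ) (hom₁ ψ) ,≈ B.thin (hom₂ φ) (hom₂ ψ)
      ; antisym  = λ φ ψ → CommaObj-≡ (A.antisym (hom₁ φ) (hom₁ ψ))
                                      (B.antisym (hom₂ φ) (hom₂ ψ))
      ; ⊓        = ⊓ᶜ
      ; ⊓-isMeet = ⊓ᶜ-isMeet
      ; *-preserves-meets = λ u es m m-isMeet →
          isMeet-pair (A.*-preserves-meets u _ _ (isMeet-left m-isMeet))
                      (B.*-preserves-meets u _ _ (isMeet-right m-isMeet))
      }

    -- A cartesian φ : x → y over u receives a vertical map from u* y, so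
    -- its components lie above the cartesian lifts.
    π₁ : _⟶_ C comma A
    π₁ = record
      { dat             = record { F₀ = left ; F₁ = hom₁ }
      ; fibred          = record
        { F-id   = A.≈′-refl
        ; F-∘    = A.≈′-refl
        ; F-resp = ≈₁
        ; F-cart = λ {_} {_} {u} {_} {y} {φ} φ-cart →
            isCartesian-if-above-cartesian A.disp A′.thinOver
              (A.lift-cart u (left y))
              (hom₁ (IsCartesian.factor φ-cart identityʳ (liftᶜ u y))) (hom₁ φ)
        }
      ; preserves-meets = λ _ _ → isMeet-left
      }

    π₂ : _⟶_ C comma B
    π₂ = record
      { dat             = record { F₀ = right ; F₁ = hom₂ }
      ; fibred          = record
        { F-id   = B.≈′-refl
        ; F-∘    = B.≈′-refl
        ; F-resp = ≈₂
        ; F-cart = λ {_} {_} {u} {_} {y} {φ} φ-cart →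
            isCartesian-if-above-cartesian B.disp B′.thinOver
              (B.lift-cart u (right y))
              (hom₂ (IsCartesian.factor φ-cart identityʳ (liftᶜ u y))) (hom₂ φ)
        }
      ; preserves-meets = λ _ _ → isMeet-right
      }

    cell : _⇒₂_ C (_∘₁_ C f π₁) (_∘₁_ C g π₂)
    cell = record
      { η       = leq
      ; commute = λ _ → D′.thinOver _ _ id-comm
      }

    pairing : {Y : CLatFib C κ} (p : _⟶_ C Y A) (q : _⟶_ C Y B) →
              _⇒₂_ C (_∘₁_ C f p) (_∘₁_ C g q) → _⟶_ C Y comma
    pairing p q α = record
      { dat             = record
        { F₀ = λ y → commaObj (p.F₀ y) (q.F₀ y) (NatTrans.η α y)
        ; F₁ = λ k → p.F₁ k ,, q.F₁ k
        }
      ; fibred          = record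
        { F-id   = p.F-id ,≈ q.F-id
        ; F-∘    = p.F-∘ ,≈ q.F-∘
        ; F-resp = λ k≈k′ → p.F-resp k≈k′ ,≈ q.F-resp k≈k′
        ; F-cart = λ k-cart → isCartesian-pair (p.F-cart k-cart) (q.F-cart k-cart)
        }
      ; preserves-meets = λ es m m-isMeet →
          isMeet-pair (p.preserves-meets es m m-isMeet) (q.preserves-meets es m m-isMeet)
      }
      where
        module p = _⟶_ p
        module q = _⟶_ q

    isComma : IsComma C f g comma π₁ π₂ cell
    isComma = record
      { fill         = pairing
      ; fill-p       = λ _ _ _ → record { eq₀ = λ _ → refl ; eq₁ = λ _ → A′.thinOver _ _ ≈-refl }
      ; fill-q       = λ _ _ _ → record { eq₀ = λ _ → refl ; eq₁ = λ _ → B′.thinOver _ _ ≈-refl }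
      ; fill-α       = λ _ _ _ _ → D′.thinOver _ _ ≈-refl
      ; fill-unique  = λ _ _ _ _ ph qh _ → record
          { eq₀ = λ y → CommaObj-≡ (_≐_.eq₀ ph y) (_≐_.eq₀ qh y)
          ; eq₁ = λ _ → thinOver _ _ ≈-refl
          }
      ; lift₂        = λ _ _ β₁ β₂ _ →
          record { η       = λ y → NatTrans.η β₁ y ,, NatTrans.η β₂ y
                 ; commute = λ _ → thinOver _ _ id-comm }
          , (λ _ → A′.thinOver _ _ ≈-refl) , (λ _ → B′.thinOver _ _ ≈-refl)
      ; lift₂-unique = λ _ _ _ _ _ _ _ _ _ _ _ _ → thinOver _ _ ≈-refl
      }

lemma2 : {o ℓ e κ : Level} (C : Category o ℓ e) {A B D : CLatFib C κ}
    (f : _⟶_ C A D) (g : _⟶_ C B D) → CommaObject C f g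
lemma2 C f g = record
  { obj     = comma
  ; π₁      = π₁
  ; π₂      = π₂
  ; cell    = cell
  ; isComma = isComma
  }
  where open Comma C f g
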